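{- Let $p$ be a prime, $t\ge1$, $q=p^t$, and let $\mathcal{C}\subseteq(\mathbb{Z}_q)^n$ be a linear code of rank $K$. If $d_L(\mathcal{C})>p^{t-1}\mu_p(n-K)$, then $\mathcal{C}$ is MDR, i.e. its minimum Hamming distance equals $n-K+1$. In particular, if $\mathcal{C}$ is moreover a free code, then $\mathcal{C}$ is MDS.
   Context: A linear code of length $n$ over $\mathbb{Z}_{q}$, $q=p^t$, is a $\mathbb{Z}_q$-submodule $\mathcal{C}$ of $(\mathbb{Z}_q)^n$; it is isomorphic to $(\mathbb{Z}_{p^t})^{k_1}\times(\mathbb{Z}_{p^{t-1}})^{k_2}\times\cdots\times(\mathbb{Z}_p)^{k_t}$, its rank is $K=\sum_i k_i$, and it is free if $K=k_1$. The minimum Hamming distance $d$ of a linear code of rank $K$ satisfies $d\le n-K+1$; the code is called MDR if equality holds, and a free code is MDS if it meets the Singleton bound $d=n-K+1$. The Lee weight of $a\in\mathbb{Z}_q$ (as an integer in $\{0,\dots,q-1\}$) is $\min\{a,q-a\}$, the Lee weight of a vector is the sum over coordinates, and $d_L(\mathcal{C})$ is the minimum Lee weight of a nonzero codeword. $\mu_p$ is the average Lee weight of the nonzero elements of $\mathbb{Z}_p$: $\mu_2=1$ and $\mu_p=\frac{p+1}{4}$ for odd $p$. -}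

module Defs where

open import Data.Nat using (ℕ; zero; suc; _+_; _*_; _∸_; _^_; _≤_; _<_; _⊓_)
open import Data.Nat.DivMod using (_%_; m%n<n)
open import Data.Fin using (Fin; toℕ; fromℕ<)
open import Data.Vec using (Vec; zipWith; map; replicate; sum)
open import Data.Product using (Σ; ∃; _×_; _,_)
open import Data.Empty using (⊥)
open import Relation.Binary.PropositionalEquality using (_≡_)
open import Relation.Nullary using (¬_)

addF : ∀ {m} → Fin m → Fin m → Fin m
addF {suc m} a b = fromℕ< (m%n<n (toℕ a + toℕ b) (suc m))

mulF : ∀ {m} → Fin m → Fin m → Fin m
mulF {suc m} a b = fromℕ< (m%n<n (toℕ a * toℕ b) (suc m))

zeroF : ∀ {m} → Fin (suc m)
zeroF = Fin.zero

Word : ℕ → ℕ → Set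
Word q n = Vec (Fin q) n

addW : ∀ {q n} → Word q n → Word q n → Word q n
addW = zipWith addF

smulW : ∀ {q n} → Fin q → Word q n → Word q n
smulW c = map (mulF c)

zeroW : ∀ {q n} → Word (suc q) n
zeroW = replicate _ Fin.zero

record IsLinearCode {q' n : ℕ} (C : Word (suc q') n → Set) : Set where
  field
    has-zero : C zeroW
    closed-add : ∀ u v → C u → C v → C (addW u v)
    closed-smul : ∀ c v → C v → C (smulW c v)

Elt : (p K : ℕ) → (e : Fin K → ℕ) → Set
Elt p K e = (j : Fin K) → Fin (p ^ e j)

addE : ∀ {p K e} → Elt p K e → Elt p K e → Elt p K e
addE x y j = addF (x j) (y j)

-- C ≅ ∏_{j<K} ℤ_{p^{e j}} with 1 ≤ e j ≤ t (as ℤ_q-modules; additive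
-- isomorphisms between ℤ_q-modules are automatically ℤ_q-linear).
-- Grouping the factors by exponent gives (ℤ_{p^t})^{k_1}×⋯×(ℤ_p)^{k_t}, K = Σ k_i.
record HasType {q' n : ℕ} (C : Word (suc q') n → Set) (p t K : ℕ) (e : Fin K → ℕ) : Set where
  field
    exp-range : ∀ j → 1 ≤ e j × e j ≤ t
    φ : Elt p K e → Word (suc q') n
    φ-add : ∀ x y → φ (addE {p} {K} {e} x y) ≡ addW (φ x) (φ y)
    φ-inj : ∀ x y → φ x ≡ φ y → ∀ j → x j ≡ y j
    φ-onto : ∀ v → C v → Σ (Elt p K e) (λ x → φ x ≡ v)
    φ-into : ∀ x → C (φ x)

HasRank : {q' n : ℕ} (C : Word (suc q') n → Set) (p t K : ℕ) → Set
HasRank C p t K = Σ (Fin K → ℕ) (λ e → HasType C p t K e)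

IsFreeOfRank : {q' n : ℕ} (C : Word (suc q') n → Set) (p t K : ℕ) → Set
IsFreeOfRank C p t K = HasType C p t K (λ _ → t)

hammingWt : ∀ {q n} → Word q n → ℕ
hammingWt v = sum (map (λ a → if0 (toℕ a)) v)
  where
  if0 : ℕ → ℕ
  if0 zero = 0
  if0 (suc _) = 1

leeF : ∀ {q} → Fin q → ℕ
leeF {q} a = toℕ a ⊓ (q ∸ toℕ a)

leeWt : ∀ {q n} → Word q n → ℕ
leeWt v = sum (map leeF v)

IsMinWt : {q' n : ℕ} (wt : Word (suc q') n → ℕ) (C : Word (suc q') n → Set) (d : ℕ) → Set
IsMinWt wt C d =
  Σ _ (λ c → C c × ¬ (c ≡ zeroW) × wt c ≡ d)
  × (∀ c → C c → ¬ (c ≡ zeroW) → d ≤ wt c)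

MinHamming : {q' n : ℕ} (C : Word (suc q') n → Set) (d : ℕ) → Set
MinHamming = IsMinWt hammingWt

MinLee : {q' n : ℕ} (C : Word (suc q') n → Set) (d : ℕ) → Set
MinLee = IsMinWt leeWt

-- 4 · μ_p  (μ_2 = 1, μ_p = (p+1)/4 for odd p)
fourμ : ℕ → ℕ
fourμ 2 = 4
fourμ p = p + 1

IsMDR : {q' n : ℕ} (C : Word (suc q') n → Set) (p t K : ℕ) → Set
IsMDR {n = n} C p t K = HasRank C p t K × MinHamming C (n ∸ K + 1)

IsMDS : {q' n : ℕ} (C : Word (suc q') n → Set) (p t K : ℕ) → Set
IsMDS {n = n} C p t K = IsFreeOfRank C p t K × MinHamming C (n ∸ K + 1)

-- Lower bound: multiplying a nonzero codeword c by a suitable power of p gives a nonzero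
-- codeword c′ with p·c′ = 0 and wt_H(c′) ≤ wt_H(c), i.e. c′ = p^(t-1)·a with a ∈ (ℤ_p)^n.
-- Summing the Lee weights of l·c′ over l ∈ ℤ_p gives p^(t-1)·wt_H(c′)·∑_{r ∈ ℤ_p} lee(r)
-- ≤ (p−1)·p^(t-1)·μ_p·wt_H(c′), so some nonzero multiple has Lee weight at most
-- p^(t-1)·μ_p·wt_H(c). Hence the hypothesis on d_L forces every nonzero codeword to have
-- Hamming weight > n − K.
-- Upper bound (generalized Singleton bound): if C ≅ ∏_j ℤ_{p^(e_j)}, the images of the
-- elements p^(e_j − 1)·ε_j are K codewords satisfying no linear relation modulo q unless all
-- coefficients are divisible by p. This property survives p-adic Gaussian elimination, which
-- clears the first K − 1 coordinates and leaves a nonzero codeword of weight ≤ n − K + 1.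

module Submission where

open import Defs
open import Level using (0ℓ)
open import Algebra.Bundles using (RawMonoid)
import Algebra.Definitions.RawMonoid as Multiples
open import Data.Empty using (⊥-elim)
open import Data.Fin as Fin using (Fin; toℕ; fromℕ<; punchIn; punchOut)
import Data.Fin.Properties as Fin
open import Data.Fin.Permutation using (permutation)
open import Data.Nat
open import Data.Nat.Divisibility
open import Data.Nat.DivMod
open import Data.Nat.Primality using (Prime; prime⇒irreducible; prime⇒nonZero; prime⇒nonTrivial; euclidsLemma)
open import Data.Nat.Properties
open import Data.Nat.Tactic.RingSolver using (solve-∀)
open import Algebra.Properties.Semiring.Sum +-*-semiring
  using ( sum; sum-syntax; sum-cong-≗; sum-replicate-zero; sum-remove; sum-permute
        ; ∑-comm; ∑-distrib-+; *-distribˡ-sum; *-distribʳ-sum)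
open import Data.Product using (∃; _×_; _,_; proj₁; proj₂)
open import Data.Sum using (_⊎_; inj₁; inj₂; [_,_])
open import Data.Vec using ([]; _∷_; lookup)
import Data.Vec.Properties as Vec
open import Function using (_∘_)
open import Function.Definitions using (Injective)
open import Relation.Binary.PropositionalEquality
  using (_≡_; _≢_; refl; sym; trans; cong; cong₂; subst; subst₂; module ≡-Reasoning)
open import Relation.Nullary using (¬_; yes; no)
open import Relation.Nullary.Decidable using (_×-dec_; ¬?)

sum-≗0 : ∀ {r} (f : Fin r → ℕ) → (∀ i → f i ≡ 0) → sum f ≡ 0
sum-≗0 {r} f f≗0 = trans (sum-cong-≗ f≗0) (sum-replicate-zero r)

sum-mono-≤ : ∀ {r} {f g : Fin r → ℕ} → (∀ i → f i ≤ g i) → sum f ≤ sum g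
sum-mono-≤ {zero} f≤g = z≤n
sum-mono-≤ {suc r} f≤g = +-mono-≤ (f≤g Fin.zero) (sum-mono-≤ (f≤g ∘ Fin.suc))

sum-const : ∀ r c → ∑[ i < r ] c ≡ r * c
sum-const zero c = refl
sum-const (suc r) c = cong (c +_) (sum-const r c)

sum-single : ∀ {r} (f : Fin r → ℕ) k → (∀ j → j ≢ k → f j ≡ 0) → sum f ≡ f k
sum-single {suc r} f k f≡0 = begin
  sum f                                    ≡⟨ sum-remove {i = k} f ⟩
  f k + ∑[ l < _ ] f (punchIn k l)         ≡⟨ cong (f k +_) (sum-≗0 _ (λ l → f≡0 _ (Fin.punchInᵢ≢i k l))) ⟩
  f k + 0                                  ≡⟨ +-identityʳ (f k) ⟩
  f k                                      ∎
  where open ≡-Reasoning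

pred*≤sum : ∀ {r} (f : Fin r → ℕ) {b} → (∀ i → toℕ i ≢ 0 → b ≤ f i) → pred r * b ≤ sum f
pred*≤sum {zero} f b≤f = z≤n
pred*≤sum {suc r} f {b} b≤f = begin
  r * b                   ≡⟨ sum-const r b ⟨
  ∑[ i < r ] b            ≤⟨ sum-mono-≤ (λ i → b≤f (Fin.suc i) λ ()) ⟩
  ∑[ i < r ] f (Fin.suc i) ≤⟨ m≤n+m _ (f Fin.zero) ⟩
  sum f                   ∎
  where open ≤-Reasoning

sum≤pred*⇒∃≤ : ∀ {r} (f : Fin r → ℕ) {b} → 1 < r → sum f ≤ pred r * b → ∃ λ i → toℕ i ≢ 0 × f i ≤ b
sum≤pred*⇒∃≤ {suc r} f {b} (s≤s 0<r) sum≤ with Fin.any? (λ i → ¬? (toℕ i ≟ 0) ×-dec (f i ≤? b))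
... | yes found = found
... | no none = ⊥-elim (<⇒≱ (*-monoʳ-< r {{>-nonZero 0<r}} (n<1+n b)) (≤-trans (pred*≤sum f b<f) sum≤))
  where
  b<f : ∀ i → toℕ i ≢ 0 → suc b ≤ f i
  b<f i i≢0 with f i ≤? b
  ... | yes fi≤b = ⊥-elim (none (i , i≢0 , fi≤b))
  ... | no fi≰b = ≰⇒> fi≰b

injective⇒surjective : ∀ {r} {f : Fin r → Fin r} → Injective _≡_ _≡_ f → ∀ y → ∃ λ x → f x ≡ y
injective⇒surjective {r} {f} f-inj y with Fin.any? (λ x → f x Fin.≟ y)
... | yes hit = hit
injective⇒surjective {suc r} {f} f-inj y | no miss =
  ⊥-elim (<⇒≱ (n<1+n r) (Fin.injective⇒≤ (f-inj ∘ Fin.punchOut-injective (≢y _) (≢y _))))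
  where
  ≢y : ∀ x → y ≢ f x
  ≢y x y≡fx = miss (x , sym y≡fx)

sum-reindex-injective : ∀ {r} {f : Fin r → Fin r} → Injective _≡_ _≡_ f →
                        (F : Fin r → ℕ) → sum (F ∘ f) ≡ sum F
sum-reindex-injective {f = f} f-inj F = sym (sum-permute F π)
  where
  f⁻¹ = λ y → proj₁ (injective⇒surjective f-inj y)
  π = permutation f f⁻¹ (λ y → proj₂ (injective⇒surjective f-inj y))
                        (λ x → f-inj (proj₂ (injective⇒surjective f-inj (f x))))

module _ {d : ℕ} .{{_ : NonZero d}} where

  %-cong-+ : ∀ {a a′ b b′} → a % d ≡ a′ % d → b % d ≡ b′ % d → (a + b) % d ≡ (a′ + b′) % d
  %-cong-+ {a} {a′} {b} {b′} a≡a′ b≡b′ = begin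
    (a + b) % d             ≡⟨ %-distribˡ-+ a b d ⟩
    (a % d + b % d) % d     ≡⟨ cong₂ (λ x y → (x + y) % d) a≡a′ b≡b′ ⟩
    (a′ % d + b′ % d) % d   ≡⟨ %-distribˡ-+ a′ b′ d ⟨
    (a′ + b′) % d           ∎
    where open ≡-Reasoning

  %-cong-* : ∀ {a a′ b b′} → a % d ≡ a′ % d → b % d ≡ b′ % d → (a * b) % d ≡ (a′ * b′) % d
  %-cong-* {a} {a′} {b} {b′} a≡a′ b≡b′ = begin
    (a * b) % d               ≡⟨ %-distribˡ-* a b d ⟩
    (a % d * (b % d)) % d     ≡⟨ cong₂ (λ x y → (x * y) % d) a≡a′ b≡b′ ⟩
    (a′ % d * (b′ % d)) % d   ≡⟨ %-distribˡ-* a′ b′ d ⟨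
    (a′ * b′) % d             ∎
    where open ≡-Reasoning

  sum-%-cong : ∀ {r} {f g : Fin r → ℕ} → (∀ i → f i % d ≡ g i % d) → sum f % d ≡ sum g % d
  sum-%-cong {zero} f≡g = refl
  sum-%-cong {suc r} f≡g = %-cong-+ (f≡g Fin.zero) (sum-%-cong (f≡g ∘ Fin.suc))

  %≡%⇒∣∸ : ∀ {x y} → y ≤ x → x % d ≡ y % d → d ∣ x ∸ y
  %≡%⇒∣∸ {x} {y} y≤x x≡y = divides (x / d ∸ y / d) (begin
    x ∸ y                                     ≡⟨ cong₂ _∸_ (m≡m%n+[m/n]*n x d) (m≡m%n+[m/n]*n y d) ⟩
    (x % d + x / d * d) ∸ (y % d + y / d * d) ≡⟨ cong (λ r → (r + x / d * d) ∸ (y % d + y / d * d)) x≡y ⟩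
    (y % d + x / d * d) ∸ (y % d + y / d * d) ≡⟨ [m+n]∸[m+o]≡n∸o (y % d) _ _ ⟩
    x / d * d ∸ y / d * d                     ≡⟨ *-distribʳ-∸ d (x / d) (y / d) ⟨
    (x / d ∸ y / d) * d                       ∎)
    where open ≡-Reasoning

∣∧<⇒≡0 : ∀ {d x} → d ∣ x → x < d → x ≡ 0
∣∧<⇒≡0 {x = zero} _ _ = refl
∣∧<⇒≡0 {x = suc x} d∣x x<d = ⊥-elim (<⇒≱ x<d (∣⇒≤ d∣x))

x+x≡x⇒x≡0 : ∀ {d} .{{_ : NonZero d}} {x} → x < d → (x + x) % d ≡ x → x ≡ 0
x+x≡x⇒x≡0 {d} {x} x<d x+x≡x = ∣∧<⇒≡0 (subst (d ∣_) (m+n∸n≡m x x) d∣x+x∸x) x<d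
  where
  d∣x+x∸x : d ∣ x + x ∸ x
  d∣x+x∸x = %≡%⇒∣∸ (m≤n+m x x) (trans x+x≡x (sym (m<n⇒m%n≡m x<d)))

∸≤suc∸suc : ∀ m n → m ∸ n ≤ suc (m ∸ suc n)
∸≤suc∸suc zero zero = z≤n
∸≤suc∸suc zero (suc n) = z≤n
∸≤suc∸suc (suc m) zero = ≤-refl
∸≤suc∸suc (suc m) (suc n) = ∸≤suc∸suc m n

isNonzero : ℕ → ℕ
isNonzero zero = 0
isNonzero (suc _) = 1

isNonzero-*ʳ : ∀ x D .{{_ : NonZero D}} → isNonzero (x * D) ≡ isNonzero x
isNonzero-*ʳ zero D = refl
isNonzero-*ʳ (suc x) (suc D) = refl

toℕ-addF : ∀ {N} .{{_ : NonZero N}} (a b : Fin N) → toℕ (addF a b) ≡ (toℕ a + toℕ b) % N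
toℕ-addF {suc N} a b = Fin.toℕ-fromℕ< _

toℕ-mulF : ∀ {N} .{{_ : NonZero N}} (a b : Fin N) → toℕ (mulF a b) ≡ (toℕ a * toℕ b) % N
toℕ-mulF {suc N} a b = Fin.toℕ-fromℕ< _

coord : ∀ {q n} → Word q n → Fin n → ℕ
coord v i = toℕ (lookup v i)

module _ {q′ : ℕ} where

  coord<q : ∀ {n} (v : Word (suc q′) n) i → coord v i < suc q′
  coord<q v i = Fin.toℕ<n (lookup v i)

  coord-addW : ∀ {n} (u v : Word (suc q′) n) i → coord (addW u v) i ≡ (coord u i + coord v i) % suc q′
  coord-addW u v i rewrite Vec.lookup-zipWith addF i u v = toℕ-addF (lookup u i) (lookup v i)

  coord-smulW : ∀ {n} c (v : Word (suc q′) n) i → coord (smulW c v) i ≡ (toℕ c * coord v i) % suc q′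
  coord-smulW c v i rewrite Vec.lookup-map i (mulF c) v = toℕ-mulF c (lookup v i)

  coord-zeroW : ∀ {n} i → coord (zeroW {q′} {n}) i ≡ 0
  coord-zeroW {suc n} Fin.zero = refl
  coord-zeroW {suc n} (Fin.suc i) = coord-zeroW i

  coord-injective : ∀ {n} {u v : Word (suc q′) n} → (∀ i → coord u i ≡ coord v i) → u ≡ v
  coord-injective {u = []} {[]} u≗v = refl
  coord-injective {u = x ∷ u} {y ∷ v} u≗v =
    cong₂ _∷_ (Fin.toℕ-injective (u≗v Fin.zero)) (coord-injective (u≗v ∘ Fin.suc))

  coords≡0⇒≡zeroW : ∀ {n} (v : Word (suc q′) n) → (∀ i → coord v i ≡ 0) → v ≡ zeroW
  coords≡0⇒≡zeroW v v≗0 = coord-injective (λ i → trans (v≗0 i) (sym (coord-zeroW i)))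

  ≢zeroW⇒∃coord≢0 : ∀ {n} (v : Word (suc q′) n) → v ≢ zeroW → ∃ λ i → coord v i ≢ 0
  ≢zeroW⇒∃coord≢0 v v≢0 with Fin.all? (λ i → coord v i ≟ 0)
  ... | yes v≗0 = ⊥-elim (v≢0 (coords≡0⇒≡zeroW v v≗0))
  ... | no ¬v≗0 = Fin.¬∀⟶∃¬ _ _ (λ i → coord v i ≟ 0) ¬v≗0

  residue : ℕ → Fin (suc q′)
  residue k = fromℕ< (m%n<n k (suc q′))

  coord-smulW-residue : ∀ {n} k (v : Word (suc q′) n) i →
                        coord (smulW (residue k) v) i ≡ (k * coord v i) % suc q′
  coord-smulW-residue k v i = begin
    coord (smulW (residue k) v) i         ≡⟨ coord-smulW (residue k) v i ⟩
    (toℕ (residue k) * coord v i) % suc q′ ≡⟨ cong (λ r → (r * coord v i) % suc q′)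
                                                   (Fin.toℕ-fromℕ< (m%n<n k (suc q′))) ⟩
    (k % suc q′ * coord v i) % suc q′     ≡⟨ %-cong-* {a = k % suc q′} {k} {coord v i} (m%n%n≡m%n k (suc q′)) refl ⟩
    (k * coord v i) % suc q′              ∎
    where open ≡-Reasoning

  hammingWt≡sum : ∀ {n} (v : Word (suc q′) n) → hammingWt v ≡ ∑[ i < n ] isNonzero (coord v i)
  hammingWt≡sum [] = refl
  hammingWt≡sum (Fin.zero ∷ v) = hammingWt≡sum v
  hammingWt≡sum (Fin.suc _ ∷ v) = cong suc (hammingWt≡sum v)

  leeWt≡sum : ∀ {n} (v : Word (suc q′) n) → leeWt v ≡ ∑[ i < n ] leeF (lookup v i)
  leeWt≡sum [] = refl
  leeWt≡sum (x ∷ v) = cong (leeF x +_) (leeWt≡sum v)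

  hammingWt-mono : ∀ {n} (u v : Word (suc q′) n) → (∀ i → coord u i ≡ 0 → coord v i ≡ 0) →
                   hammingWt v ≤ hammingWt u
  hammingWt-mono u v supp rewrite hammingWt≡sum u | hammingWt≡sum v = sum-mono-≤ pointwise
    where
    pointwise : ∀ i → isNonzero (coord v i) ≤ isNonzero (coord u i)
    pointwise i with coord u i in eq
    ... | zero rewrite supp i eq = z≤n
    ... | suc _ with coord v i
    ...   | zero = z≤n
    ...   | suc _ = ≤-refl

  hammingWt≤length : ∀ {n} (v : Word (suc q′) n) → hammingWt v ≤ n
  hammingWt≤length [] = z≤n
  hammingWt≤length (Fin.zero ∷ v) = m≤n⇒m≤1+n (hammingWt≤length v)
  hammingWt≤length (Fin.suc _ ∷ v) = s≤s (hammingWt≤length v)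

  hammingWt-vanishing-prefix : ∀ {n} m (v : Word (suc q′) n) → (∀ i → toℕ i < m → coord v i ≡ 0) →
                               hammingWt v ≤ n ∸ m
  hammingWt-vanishing-prefix zero v _ = hammingWt≤length v
  hammingWt-vanishing-prefix (suc m) [] _ = z≤n
  hammingWt-vanishing-prefix (suc m) (x ∷ v) v≗0 with v≗0 Fin.zero (s≤s z≤n)
  hammingWt-vanishing-prefix (suc m) (Fin.zero ∷ v) v≗0 | refl =
    hammingWt-vanishing-prefix m v (λ i i<m → v≗0 (Fin.suc i) (s≤s i<m))

_annihilates_ : ∀ {q′ n} → ℕ → Word (suc q′) n → Set
_annihilates_ {q′} m c = ∀ i → suc q′ ∣ m * coord c i

module _ {q′ n : ℕ} where

  hammingWt-smulW≤ : ∀ a (c : Word (suc q′) n) → hammingWt (smulW a c) ≤ hammingWt c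
  hammingWt-smulW≤ a c = hammingWt-mono c (smulW a c) support
    where
    support : ∀ i → coord c i ≡ 0 → coord (smulW a c) i ≡ 0
    support i cᵢ≡0 rewrite coord-smulW a c i | cᵢ≡0 | *-zeroʳ (toℕ a) = refl

  smulW≡zeroW⇒annihilates : ∀ m (c : Word (suc q′) n) → smulW (residue m) c ≡ zeroW → m annihilates c
  smulW≡zeroW⇒annihilates m c mc≡0 i = m%n≡0⇒n∣m _ (suc q′) (begin
    (m * coord c i) % suc q′      ≡⟨ coord-smulW-residue m c i ⟨
    coord (smulW (residue m) c) i ≡⟨ cong (λ w → coord w i) mc≡0 ⟩
    coord (zeroW {q′} {n}) i      ≡⟨ coord-zeroW i ⟩
    0                             ∎)
    where open ≡-Reasoning

  annihilates-smulW : ∀ a m (c : Word (suc q′) n) → (m * a) annihilates c → a annihilates smulW (residue m) c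
  annihilates-smulW a m c ma·c≡0 i = m%n≡0⇒n∣m _ (suc q′) (begin
    (a * coord (smulW (residue m) c) i) % suc q′ ≡⟨ cong (λ x → (a * x) % suc q′) (coord-smulW-residue m c i) ⟩
    (a * ((m * coord c i) % suc q′)) % suc q′    ≡⟨ %-cong-* {a = a} {a} {(m * coord c i) % suc q′} refl
                                                               (m%n%n≡m%n (m * coord c i) (suc q′)) ⟩
    (a * (m * coord c i)) % suc q′               ≡⟨ cong (_% suc q′) (trans (cong (_* coord c i) (*-comm m a)) (*-assoc a m _)) ⟨
    (m * a * coord c i) % suc q′                 ≡⟨ n∣m⇒m%n≡0 _ (suc q′) (ma·c≡0 i) ⟩
    0                                            ∎)
    where open ≡-Reasoning

  ≢zeroW⇒¬1-annihilates : ∀ (c : Word (suc q′) n) → c ≢ zeroW → ¬ 1 annihilates c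
  ≢zeroW⇒¬1-annihilates c c≢0 1·c≡0 =
    c≢0 (coords≡0⇒≡zeroW c (λ i → ∣∧<⇒≡0 (subst (suc q′ ∣_) (*-identityˡ _) (1·c≡0 i)) (coord<q c i)))

module _ {q′ n : ℕ} {C : Word (suc q′) n → Set} (lin : IsLinearCode C) where
  open IsLinearCode lin

  reduce-to-socle : ∀ p k c → C c → c ≢ zeroW → (p ^ k) annihilates c →
                    ∃ λ c′ → C c′ × c′ ≢ zeroW × p annihilates c′ × hammingWt c′ ≤ hammingWt c
  reduce-to-socle p zero c _ c≢0 1·c≡0 = ⊥-elim (≢zeroW⇒¬1-annihilates c c≢0 1·c≡0)
  reduce-to-socle p (suc k) c c∈C c≢0 p^k+1·c≡0 with Vec.≡-dec Fin._≟_ (smulW (residue p) c) zeroW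
  ... | yes pc≡0 = c , c∈C , c≢0 , smulW≡zeroW⇒annihilates p c pc≡0 , ≤-refl
  ... | no pc≢0 with reduce-to-socle p k (smulW (residue p) c) (closed-smul (residue p) c c∈C) pc≢0
                       (annihilates-smulW (p ^ k) p c p^k+1·c≡0)
  ...   | c′ , c′∈C , c′≢0 , p·c′≡0 , c′≤pc =
    c′ , c′∈C , c′≢0 , p·c′≡0 , ≤-trans c′≤pc (hammingWt-smulW≤ (residue p) c)

leeℕ : ℕ → ℕ → ℕ
leeℕ m r = r ⊓ (m ∸ r)

module _ {p : ℕ} (p-prime : Prime p) where
  private instance
    p≢0 : NonZero p
    p≢0 = prime⇒nonZero p-prime

  *-residue : ℕ → Fin p → Fin p
  *-residue a l = fromℕ< (m%n<n (toℕ l * a) p)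

  *-residue-injective : ∀ {a} → ¬ p ∣ a → Injective _≡_ _≡_ (*-residue a)
  *-residue-injective {a} p∤a {x} {y} ax≡ay = Fin.toℕ-injective (cancel (Fin.toℕ<n x) (Fin.toℕ<n y) xa≡ya)
    where
    xa≡ya : (toℕ x * a) % p ≡ (toℕ y * a) % p
    xa≡ya = trans (sym (Fin.toℕ-fromℕ< _)) (trans (cong toℕ ax≡ay) (Fin.toℕ-fromℕ< _))
    cancel-≤ : ∀ {u v} → u < p → v ≤ u → (u * a) % p ≡ (v * a) % p → u ≡ v
    cancel-≤ {u} {v} u<p v≤u ua≡va
      with euclidsLemma (u ∸ v) a p-prime
             (subst (p ∣_) (sym (*-distribʳ-∸ a u v)) (%≡%⇒∣∸ (*-monoˡ-≤ a v≤u) ua≡va))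
    ... | inj₂ p∣a = ⊥-elim (p∤a p∣a)
    ... | inj₁ p∣u∸v = ≤-antisym (m∸n≡0⇒m≤n (∣∧<⇒≡0 p∣u∸v (≤-<-trans (m∸n≤m u v) u<p))) v≤u
    cancel : ∀ {u v} → u < p → v < p → (u * a) % p ≡ (v * a) % p → u ≡ v
    cancel {u} {v} u<p v<p ua≡va with ≤-total v u
    ... | inj₁ v≤u = cancel-≤ u<p v≤u ua≡va
    ... | inj₂ u≤v = sym (cancel-≤ v<p u≤v (sym ua≡va))

  sum-leeℕ-* : ∀ {a} → ¬ p ∣ a → ∑[ l < p ] leeℕ p ((toℕ l * a) % p) ≡ ∑[ r < p ] leeF r
  sum-leeℕ-* {a} p∤a = trans (sum-cong-≗ {y = leeF ∘ *-residue a} (λ l → cong (leeℕ p) (sym (Fin.toℕ-fromℕ< _))))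
                             (sum-reindex-injective (*-residue-injective p∤a) leeF)

  sum-leeℕ-*-small : ∀ {x} → x < p → ∑[ l < p ] leeℕ p ((toℕ l * x) % p) ≡ isNonzero x * ∑[ r < p ] leeF r
  sum-leeℕ-*-small {zero} _ =
    sum-≗0 {p} _ (λ l → cong (leeℕ p) (trans (cong (_% p) (*-zeroʳ (toℕ l))) (m*n%n≡0 0 p)))
  sum-leeℕ-*-small {suc x} x<p = trans (sum-leeℕ-* (λ p∣x → <⇒≱ x<p (∣⇒≤ p∣x))) (sym (+-identityʳ _))

sumUpTo : ℕ → (ℕ → ℕ) → ℕ
sumUpTo zero g = 0
sumUpTo (suc N) g = g 0 + sumUpTo N (g ∘ suc)

sum≡sumUpTo : ∀ N g → ∑[ r < N ] g (toℕ r) ≡ sumUpTo N g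
sum≡sumUpTo zero g = refl
sum≡sumUpTo (suc N) g = cong (g 0 +_) (sum≡sumUpTo N (g ∘ suc))

sumUpTo-+ : ∀ a b g → sumUpTo (a + b) g ≡ sumUpTo a g + sumUpTo b (g ∘ (a +_))
sumUpTo-+ zero b g = refl
sumUpTo-+ (suc a) b g = trans (cong (g 0 +_) (sumUpTo-+ a b (g ∘ suc))) (sym (+-assoc (g 0) _ _))

sumUpTo-cong : ∀ N {g h} → (∀ r → r < N → g r ≡ h r) → sumUpTo N g ≡ sumUpTo N h
sumUpTo-cong zero g≡h = refl
sumUpTo-cong (suc N) g≡h = cong₂ _+_ (g≡h 0 z<s) (sumUpTo-cong N (λ r r<N → g≡h (suc r) (s<s r<N)))

sumUpTo-suc : ∀ N g → sumUpTo (suc N) g ≡ sumUpTo N g + g N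
sumUpTo-suc zero g = +-comm (g 0) 0
sumUpTo-suc (suc N) g = trans (cong (g 0 +_) (sumUpTo-suc N (g ∘ suc))) (sym (+-assoc (g 0) _ _))

2*sumUpTo-id : ∀ m → 2 * sumUpTo (suc m) (λ r → r) ≡ m * suc m
2*sumUpTo-id zero = refl
2*sumUpTo-id (suc m) = begin
  2 * sumUpTo (suc (suc m)) (λ r → r)     ≡⟨ cong (2 *_) (sumUpTo-suc (suc m) (λ r → r)) ⟩
  2 * (sumUpTo (suc m) (λ r → r) + suc m) ≡⟨ *-distribˡ-+ 2 (sumUpTo (suc m) (λ r → r)) (suc m) ⟩
  2 * sumUpTo (suc m) (λ r → r) + 2 * suc m ≡⟨ cong (_+ 2 * suc m) (2*sumUpTo-id m) ⟩
  m * suc m + 2 * suc m                   ≡⟨ expand m ⟩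
  suc m * suc (suc m)                     ∎
  where
  open ≡-Reasoning
  expand : ∀ m → m * suc m + 2 * suc m ≡ suc m * suc (suc m)
  expand = solve-∀

2*sumUpTo-reverse : ∀ m → 2 * sumUpTo m (m ∸_) ≡ m * suc m
2*sumUpTo-reverse zero = refl
2*sumUpTo-reverse (suc m) = begin
  2 * (suc m + sumUpTo m (m ∸_))       ≡⟨ *-distribˡ-+ 2 (suc m) (sumUpTo m (m ∸_)) ⟩
  2 * suc m + 2 * sumUpTo m (m ∸_)     ≡⟨ cong (2 * suc m +_) (2*sumUpTo-reverse m) ⟩
  2 * suc m + m * suc m                ≡⟨ expand m ⟩
  suc m * suc (suc m)                  ∎
  where
  open ≡-Reasoning
  expand : ∀ m → 2 * suc m + m * suc m ≡ suc m * suc (suc m)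
  expand = solve-∀

4*sumUpTo-lee-odd : ∀ m → 4 * sumUpTo (suc (m + m)) (leeℕ (suc (m + m))) ≡ (m + m) * (suc (m + m) + 1)
4*sumUpTo-lee-odd m = begin
  4 * sumUpTo (suc m + m) g                             ≡⟨ cong (4 *_) (sumUpTo-+ (suc m) m g) ⟩
  4 * (sumUpTo (suc m) g + sumUpTo m (g ∘ (suc m +_)))  ≡⟨ cong₂ (λ x y → 4 * (x + y)) (sumUpTo-cong (suc m) lower-half)
                                                                                       (sumUpTo-cong m upper-half) ⟩
  4 * (sumUpTo (suc m) (λ r → r) + sumUpTo m (m ∸_))    ≡⟨ regroup (sumUpTo (suc m) (λ r → r)) (sumUpTo m (m ∸_)) ⟩
  2 * (2 * sumUpTo (suc m) (λ r → r)) + 2 * (2 * sumUpTo m (m ∸_))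
                                                        ≡⟨ cong₂ (λ x y → 2 * x + 2 * y) (2*sumUpTo-id m) (2*sumUpTo-reverse m) ⟩
  2 * (m * suc m) + 2 * (m * suc m)                     ≡⟨ expand m ⟩
  (m + m) * (suc (m + m) + 1)                           ∎
  where
  open ≡-Reasoning
  g = leeℕ (suc (m + m))
  lower-half : ∀ r → r < suc m → g r ≡ r
  lower-half r (s≤s r≤m) = m≤n⇒m⊓n≡m (m+n≤o⇒m≤o∸n r (≤-trans (+-mono-≤ r≤m r≤m) (n≤1+n (m + m))))
  upper-half : ∀ k → k < m → g (suc m + k) ≡ m ∸ k
  upper-half k _ rewrite [m+n]∸[m+o]≡n∸o m m k =
    m≥n⇒m⊓n≡n (≤-trans (m∸n≤m m k) (≤-trans (n≤1+n m) (m≤m+n (suc m) k)))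
  regroup : ∀ x y → 4 * (x + y) ≡ 2 * (2 * x) + 2 * (2 * y)
  regroup = solve-∀
  expand : ∀ m → 2 * (m * suc m) + 2 * (m * suc m) ≡ (m + m) * (suc (m + m) + 1)
  expand = solve-∀

odd-prime≡2*half+1 : ∀ {p} → Prime p → p ≢ 2 → p ≡ suc (p / 2 + p / 2)
odd-prime≡2*half+1 {p} p-prime p≢2 =
  trans (m≡m%n+[m/n]*n p 2) (cong₂ _+_ p%2≡1 (trans (*-comm (p / 2) 2) (cong (p / 2 +_) (+-identityʳ (p / 2)))))
  where
  p%2≡1 : p % 2 ≡ 1
  p%2≡1 with p % 2 in eq | m%n<n p 2
  ... | zero | _ with prime⇒irreducible p-prime (m%n≡0⇒n∣m p 2 eq)
  ...   | inj₁ ()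
  ...   | inj₂ 2≡p = ⊥-elim (p≢2 (sym 2≡p))
  p%2≡1 | suc zero | _ = refl
  p%2≡1 | suc (suc _) | s≤s (s≤s ())

fourμ-odd : ∀ p → p ≢ 2 → fourμ p ≡ p + 1
fourμ-odd 0 _ = refl
fourμ-odd 1 _ = refl
fourμ-odd 2 p≢2 = ⊥-elim (p≢2 refl)
fourμ-odd (suc (suc (suc p))) _ = refl

4*sum-lee≤pred*fourμ : ∀ {p} → Prime p → 4 * ∑[ r < p ] leeF r ≤ pred p * fourμ p
4*sum-lee≤pred*fourμ {p} p-prime with p ≟ 2
... | yes refl = ≤-refl
... | no p≢2 = ≤-reflexive (begin
  4 * ∑[ r < p ] leeF r                 ≡⟨ cong (4 *_) (sum≡sumUpTo p (leeℕ p)) ⟩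
  4 * sumUpTo p (leeℕ p)                ≡⟨ cong (λ p → 4 * sumUpTo p (leeℕ p)) p≡2m+1 ⟩
  4 * sumUpTo (suc (m + m)) (leeℕ (suc (m + m))) ≡⟨ 4*sumUpTo-lee-odd m ⟩
  (m + m) * (suc (m + m) + 1)           ≡⟨ cong (λ p → pred p * (p + 1)) p≡2m+1 ⟨
  pred p * (p + 1)                      ≡⟨ cong (pred p *_) (fourμ-odd p p≢2) ⟨
  pred p * fourμ p                      ∎)
  where
  open ≡-Reasoning
  m = p / 2
  p≡2m+1 = odd-prime≡2*half+1 p-prime p≢2

module SocleWord {p D q′ n : ℕ} (p-prime : Prime p) .{{_ : NonZero D}} (q≡p*D : suc q′ ≡ p * D)
                 (c : Word (suc q′) n) (p·c≡0 : p annihilates c) where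
  private instance
    p≢0 : NonZero p
    p≢0 = prime⇒nonZero p-prime
    pD≢0 : NonZero (p * D)
    pD≢0 = m*n≢0 p D

  digit : Fin n → ℕ
  digit i = coord c i / D

  coord≡digit*D : ∀ i → coord c i ≡ digit i * D
  coord≡digit*D i = sym (m/n*n≡m (*-cancelˡ-∣ p (subst (_∣ p * coord c i) q≡p*D (p·c≡0 i))))

  digit<p : ∀ i → digit i < p
  digit<p i = *-cancelʳ-< D (digit i) p (subst₂ _<_ (coord≡digit*D i) q≡p*D (coord<q c i))

  multiple : Fin p → Word (suc q′) n
  multiple l = smulW (residue (toℕ l)) c

  coord-multiple : ∀ l i → coord (multiple l) i ≡ ((toℕ l * digit i) % p) * D
  coord-multiple l i = begin
    coord (multiple l) i                   ≡⟨ coord-smulW-residue (toℕ l) c i ⟩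
    (toℕ l * coord c i) % suc q′           ≡⟨ %-congʳ q≡p*D ⟩
    (toℕ l * coord c i) % (p * D)          ≡⟨ cong (λ x → (toℕ l * x) % (p * D)) (coord≡digit*D i) ⟩
    (toℕ l * (digit i * D)) % (p * D)      ≡⟨ cong (_% (p * D)) (*-assoc (toℕ l) (digit i) D) ⟨
    (toℕ l * digit i * D) % (p * D)        ≡⟨ m%n*o≡m*o%[n*o] (toℕ l * digit i) p D ⟨
    ((toℕ l * digit i) % p) * D            ∎
    where open ≡-Reasoning

  leeF-multiple : ∀ l i → leeF (lookup (multiple l) i) ≡ D * leeℕ p ((toℕ l * digit i) % p)
  leeF-multiple l i = begin
    coord (multiple l) i ⊓ (suc q′ ∸ coord (multiple l) i)
                                                           ≡⟨ cong₂ (λ x y → x ⊓ (y ∸ x)) (coord-multiple l i) q≡p*D ⟩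
    r * D ⊓ (p * D ∸ r * D)                                ≡⟨ cong (r * D ⊓_) (*-distribʳ-∸ D p r) ⟨
    r * D ⊓ ((p ∸ r) * D)                                  ≡⟨ *-distribʳ-⊓ D r (p ∸ r) ⟨
    leeℕ p r * D                                           ≡⟨ *-comm (leeℕ p r) D ⟩
    D * leeℕ p r                                           ∎
    where
    open ≡-Reasoning
    r = (toℕ l * digit i) % p

  sum-leeWt-multiples : ∑[ l < p ] leeWt (multiple l) ≡ D * (hammingWt c * ∑[ r < p ] leeF r)
  sum-leeWt-multiples = begin
    ∑[ l < p ] leeWt (multiple l)
      ≡⟨ sum-cong-≗ {p} (λ l → trans (leeWt≡sum (multiple l)) (sum-cong-≗ (leeF-multiple l))) ⟩
    ∑[ l < p ] (∑[ i < n ] (D * L l i))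
      ≡⟨ ∑-comm {p} {n} (λ l i → D * L l i) ⟩
    ∑[ i < n ] (∑[ l < p ] (D * L l i))
      ≡⟨ sum-cong-≗ {n} (λ i → *-distribˡ-sum {p} D (λ l → L l i)) ⟨
    ∑[ i < n ] (D * ∑[ l < p ] L l i)
      ≡⟨ sum-cong-≗ {n} (λ i → cong (D *_) (sum-leeℕ-*-small p-prime (digit<p i))) ⟩
    ∑[ i < n ] (D * (isNonzero (digit i) * S))
      ≡⟨ *-distribˡ-sum {n} D (λ i → isNonzero (digit i) * S) ⟨
    D * ∑[ i < n ] (isNonzero (digit i) * S)
      ≡⟨ cong (D *_) (*-distribʳ-sum S (isNonzero ∘ digit)) ⟨
    D * ((∑[ i < n ] isNonzero (digit i)) * S)
      ≡⟨ cong (λ x → D * (x * S)) (sum-cong-≗ isNonzero-coord) ⟨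
    D * ((∑[ i < n ] isNonzero (coord c i)) * S)
      ≡⟨ cong (λ x → D * (x * S)) (hammingWt≡sum c) ⟨
    D * (hammingWt c * S)
      ∎
    where
    open ≡-Reasoning
    S = ∑[ r < p ] leeF r
    L = λ l i → leeℕ p ((toℕ l * digit i) % p)
    isNonzero-coord : ∀ i → isNonzero (coord c i) ≡ isNonzero (digit i)
    isNonzero-coord i = trans (cong isNonzero (coord≡digit*D i)) (isNonzero-*ʳ (digit i) D)

  multiple≢zeroW : c ≢ zeroW → ∀ l → toℕ l ≢ 0 → multiple l ≢ zeroW
  multiple≢zeroW c≢0 l l≢0 lc≡0 with ≢zeroW⇒∃coord≢0 c c≢0
  ... | i , cᵢ≢0 with euclidsLemma (toℕ l) (digit i) p-prime p∣l*digit
    where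
    p∣l*digit : p ∣ toℕ l * digit i
    p∣l*digit = m%n≡0⇒n∣m _ p (m*n≡0⇒m≡0 _ D (trans (sym (coord-multiple l i))
                                                      (trans (cong (λ w → coord w i) lc≡0) (coord-zeroW i))))
  ...   | inj₁ p∣l = l≢0 (∣∧<⇒≡0 p∣l (Fin.toℕ<n l))
  ...   | inj₂ p∣digit = cᵢ≢0 (trans (coord≡digit*D i) (cong (_* D) (∣∧<⇒≡0 p∣digit (digit<p i))))

  ∃light-multiple : c ≢ zeroW → ∃ λ a → smulW a c ≢ zeroW × 4 * leeWt (smulW a c) ≤ D * fourμ p * hammingWt c
  ∃light-multiple c≢0 with sum≤pred*⇒∃≤ (λ l → 4 * leeWt (multiple l)) 1<p total
    where
    1<p : 1 < p
    1<p = nonTrivial⇒n>1 p {{prime⇒nonTrivial p-prime}}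
    w = hammingWt c
    total : ∑[ l < p ] (4 * leeWt (multiple l)) ≤ pred p * (D * fourμ p * w)
    total = begin
      ∑[ l < p ] (4 * leeWt (multiple l))      ≡⟨ *-distribˡ-sum 4 (leeWt ∘ multiple) ⟨
      4 * ∑[ l < p ] leeWt (multiple l)      ≡⟨ cong (4 *_) sum-leeWt-multiples ⟩
      4 * (D * (w * S))                      ≡⟨ regroup D w S ⟩
      D * w * (4 * S)                        ≤⟨ *-monoʳ-≤ (D * w) (4*sum-lee≤pred*fourμ p-prime) ⟩
      D * w * (pred p * fourμ p)             ≡⟨ regroup′ D w (pred p) (fourμ p) ⟩
      pred p * (D * fourμ p * w)             ∎
      where
      open ≤-Reasoning
      S = ∑[ r < p ] leeF r
      regroup : ∀ D w S → 4 * (D * (w * S)) ≡ D * w * (4 * S)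
      regroup = solve-∀
      regroup′ : ∀ D w a b → D * w * (a * b) ≡ a * (D * b * w)
      regroup′ = solve-∀
  ... | l , l≢0 , light = residue (toℕ l) , multiple≢zeroW c≢0 l l≢0 , light

module _ {p t q′ n : ℕ} (p-prime : Prime p) (q≡p^t+1 : suc q′ ≡ p ^ suc t)
         {C : Word (suc q′) n → Set} (lin : IsLinearCode C) where
  open IsLinearCode lin

  ∃light-codeword : ∀ c → C c → c ≢ zeroW →
                    ∃ λ c′ → C c′ × c′ ≢ zeroW × 4 * leeWt c′ ≤ p ^ t * fourμ p * hammingWt c
  ∃light-codeword c c∈C c≢0 = light-multiple (reduce-to-socle lin p (suc t) c c∈C c≢0 p^t+1·c≡0)
    where
    instance
      p^t≢0 : NonZero (p ^ t)
      p^t≢0 = m^n≢0 p t {{prime⇒nonZero p-prime}}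
    p^t+1·c≡0 : (p ^ suc t) annihilates c
    p^t+1·c≡0 i = subst (_∣ p ^ suc t * coord c i) (sym q≡p^t+1) (m∣m*n (coord c i))
    light-multiple : (∃ λ c′ → C c′ × c′ ≢ zeroW × p annihilates c′ × hammingWt c′ ≤ hammingWt c) →
                     ∃ λ c″ → C c″ × c″ ≢ zeroW × 4 * leeWt c″ ≤ p ^ t * fourμ p * hammingWt c
    light-multiple (c′ , c′∈C , c′≢0 , p·c′≡0 , c′≤c) =
      scale (SocleWord.∃light-multiple p-prime q≡p^t+1 c′ p·c′≡0 c′≢0)
      where
      scale : (∃ λ a → smulW a c′ ≢ zeroW × 4 * leeWt (smulW a c′) ≤ p ^ t * fourμ p * hammingWt c′) →
              ∃ λ c″ → C c″ × c″ ≢ zeroW × 4 * leeWt c″ ≤ p ^ t * fourμ p * hammingWt c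
      scale (a , ac′≢0 , light) =
        smulW a c′ , closed-smul a c′ c′∈C , ac′≢0 , ≤-trans light (*-monoʳ-≤ (p ^ t * fourμ p) c′≤c)

  4*minLee≤p^t*fourμ*hammingWt : ∀ {dL} → MinLee C dL → ∀ c → C c → c ≢ zeroW →
                                 4 * dL ≤ p ^ t * fourμ p * hammingWt c
  4*minLee≤p^t*fourμ*hammingWt {dL} (_ , dL≤) c c∈C c≢0 = bound (∃light-codeword c c∈C c≢0)
    where
    bound : (∃ λ c′ → C c′ × c′ ≢ zeroW × 4 * leeWt c′ ≤ p ^ t * fourμ p * hammingWt c) →
            4 * dL ≤ p ^ t * fourμ p * hammingWt c
    bound (c′ , c′∈C , c′≢0 , light) = ≤-trans (*-monoʳ-≤ 4 (dL≤ c′ c′∈C c′≢0)) light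

record Pivot (p : ℕ) {r} (a : Fin r → ℕ) : Set where
  field
    index : Fin r
    valuation : ℕ
    unit : ℕ
    index-value : a index ≡ p ^ valuation * unit
    p∤unit : ¬ p ∣ unit
    p^valuation∣ : ∀ j → p ^ valuation ∣ a j

all-zero-or-pivot : ∀ p t {r} (a : Fin r → ℕ) → (∀ j → a j < p ^ t) → (∀ j → a j ≡ 0) ⊎ Pivot p a
all-zero-or-pivot p t {r} a a<p^t = search t 0 (+-identityʳ t) (λ j → 1∣ a j)
  where
  search : ∀ k v → k + v ≡ t → (∀ j → p ^ v ∣ a j) → (∀ j → a j ≡ 0) ⊎ Pivot p a
  search zero v refl p^v∣ = inj₁ (λ j → ∣∧<⇒≡0 (p^v∣ j) (a<p^t j))
  search (suc k) v k+v+1≡t p^v∣ with Fin.all? (λ j → p ^ suc v ∣? a j)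
  ... | yes p^v+1∣ = search k (suc v) (trans (+-suc k v) k+v+1≡t) p^v+1∣
  ... | no ¬p^v+1∣ with Fin.¬∀⟶∃¬ _ _ (λ j → p ^ suc v ∣? a j) ¬p^v+1∣
  ...   | j₀ , p^v+1∤ = inj₂ record
    { index = j₀ ; valuation = v ; unit = u ; index-value = m∣n⇒n≡m*quotient (p^v∣ j₀)
    ; p∤unit = p∤u ; p^valuation∣ = p^v∣ }
    where
    u = quotient (p^v∣ j₀)
    p∤u : ¬ p ∣ u
    p∤u p∣u = p^v+1∤ (subst₂ _∣_ (*-comm (p ^ v) p) (sym (m∣n⇒n≡m*quotient (p^v∣ j₀))) (*-monoʳ-∣ (p ^ v) p∣u))

module _ {q′ n : ℕ} where

  IndependentMod : ℕ → ∀ {r} → (Fin r → Word (suc q′) n) → Set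
  IndependentMod p {r} h = ∀ (b : Fin r → ℕ) → (∀ i → suc q′ ∣ ∑[ j < r ] (b j * coord (h j) i)) → ∀ j → p ∣ b j

  VanishBelow : ℕ → ∀ {r} → (Fin r → Word (suc q′) n) → Set
  VanishBelow m h = ∀ j i → toℕ i < m → coord (h j) i ≡ 0

  VanishBelow-suc : ∀ {m r} {h : Fin r → Word (suc q′) n} i₀ → toℕ i₀ ≡ m →
                    VanishBelow m h → (∀ j → coord (h j) i₀ ≡ 0) → VanishBelow (suc m) h
  VanishBelow-suc i₀ i₀≡m h≡0 column≡0 j i (s≤s i≤m) with m≤n⇒m<n∨m≡n i≤m
  ... | inj₁ i<m = h≡0 j i i<m
  ... | inj₂ i≡m rewrite Fin.toℕ-injective (trans i≡m (sym i₀≡m)) = column≡0 j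

  independent⇒head≢zeroW : ∀ {p r} {h : Fin (suc r) → Word (suc q′) n} → 1 < p →
                           IndependentMod p h → h Fin.zero ≢ zeroW
  independent⇒head≢zeroW {r = r} {h} 1<p h-indep h₀≡0 = <⇒≱ 1<p (∣⇒≤ (h-indep b relation Fin.zero))
    where
    b : Fin (suc r) → ℕ
    b Fin.zero = 1
    b (Fin.suc _) = 0
    relation : ∀ i → suc q′ ∣ ∑[ j < suc r ] (b j * coord (h j) i)
    relation i = subst (suc q′ ∣_) (sym (cong₂ _+_ h₀ᵢ≡0 (sum-≗0 {r} (λ _ → 0) (λ _ → refl)))) (suc q′ ∣0)
      where
      h₀ᵢ≡0 : 1 * coord (h Fin.zero) i ≡ 0
      h₀ᵢ≡0 = trans (*-identityˡ _) (trans (cong (λ w → coord w i) h₀≡0) (coord-zeroW i))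

module Pivoting {q′ n r : ℕ} (h : Fin (suc r) → Word (suc q′) n) (j₀ : Fin (suc r)) (u : ℕ) (c : Fin r → ℕ) where

  combined : Fin r → Word (suc q′) n
  combined k = addW (smulW (residue u) (h (punchIn j₀ k))) (smulW (residue (c k)) (h j₀))

  coord-combined : ∀ k i → coord (combined k) i ≡ (u * coord (h (punchIn j₀ k)) i + c k * coord (h j₀) i) % suc q′
  coord-combined k i = begin
    coord (combined k) i
      ≡⟨ coord-addW (smulW (residue u) (h (punchIn j₀ k))) (smulW (residue (c k)) (h j₀)) i ⟩
    (coord (smulW (residue u) (h (punchIn j₀ k))) i + coord (smulW (residue (c k)) (h j₀)) i) % suc q′
      ≡⟨ cong₂ (λ x y → (x + y) % suc q′) (coord-smulW-residue u (h (punchIn j₀ k)) i)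
                                           (coord-smulW-residue (c k) (h j₀) i) ⟩
    ((u * coord (h (punchIn j₀ k)) i) % suc q′ + (c k * coord (h j₀) i) % suc q′) % suc q′
      ≡⟨ %-distribˡ-+ (u * coord (h (punchIn j₀ k)) i) (c k * coord (h j₀) i) (suc q′) ⟨
    (u * coord (h (punchIn j₀ k)) i + c k * coord (h j₀) i) % suc q′
      ∎
    where open ≡-Reasoning

  combined∈C : ∀ {C : Word (suc q′) n → Set} → IsLinearCode C → (∀ j → C (h j)) → ∀ k → C (combined k)
  combined∈C lin h∈C k =
    closed-add _ _ (closed-smul (residue u) _ (h∈C (punchIn j₀ k))) (closed-smul (residue (c k)) _ (h∈C j₀))
    where open IsLinearCode lin

  combined-vanish : ∀ {m} → VanishBelow m h → VanishBelow m combined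
  combined-vanish h≡0 k i i<m
    rewrite coord-combined k i | h≡0 (punchIn j₀ k) i i<m | h≡0 j₀ i i<m | *-zeroʳ u | *-zeroʳ (c k) = refl

  lift : (Fin r → ℕ) → Fin (suc r) → ℕ
  lift b j with j₀ Fin.≟ j
  ... | yes _ = ∑[ k < r ] (b k * c k)
  ... | no j₀≢j = u * b (punchOut j₀≢j)

  lift-pivot : ∀ b → lift b j₀ ≡ ∑[ k < r ] (b k * c k)
  lift-pivot b with j₀ Fin.≟ j₀
  ... | yes _ = refl
  ... | no j₀≢j₀ = ⊥-elim (j₀≢j₀ refl)

  lift-punchIn : ∀ b k → lift b (punchIn j₀ k) ≡ u * b k
  lift-punchIn b k with j₀ Fin.≟ punchIn j₀ k
  ... | yes j₀≡ = ⊥-elim (Fin.punchInᵢ≢i j₀ k (sym j₀≡))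
  ... | no j₀≢ = cong (λ l → u * b l) (trans (Fin.punchOut-cong j₀ refl) (Fin.punchOut-punchIn j₀))

  lift-relation : ∀ b i → ∑[ j < suc r ] (lift b j * coord (h j) i) ≡
                          ∑[ k < r ] (b k * (u * coord (h (punchIn j₀ k)) i + c k * coord (h j₀) i))
  lift-relation b i = begin
    ∑[ j < suc r ] (lift b j * coord (h j) i)
      ≡⟨ sum-remove {i = j₀} (λ j → lift b j * coord (h j) i) ⟩
    lift b j₀ * H₀ + ∑[ k < r ] (lift b (punchIn j₀ k) * H k)
      ≡⟨ cong₂ _+_ (cong (_* H₀) (lift-pivot b)) (sum-cong-≗ {r} (λ k → cong (_* H k) (lift-punchIn b k))) ⟩
    ∑[ k < r ] (b k * c k) * H₀ + ∑[ k < r ] (u * b k * H k)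
      ≡⟨ cong (_+ ∑[ k < r ] (u * b k * H k)) (*-distribʳ-sum H₀ (λ k → b k * c k)) ⟩
    ∑[ k < r ] (b k * c k * H₀) + ∑[ k < r ] (u * b k * H k)
      ≡⟨ ∑-distrib-+ (λ k → b k * c k * H₀) (λ k → u * b k * H k) ⟨
    ∑[ k < r ] (b k * c k * H₀ + u * b k * H k)
      ≡⟨ sum-cong-≗ {r} (λ k → regroup (b k) u (H k) (c k) H₀) ⟩
    ∑[ k < r ] (b k * (u * H k + c k * H₀))
      ∎
    where
    open ≡-Reasoning
    H₀ = coord (h j₀) i
    H = λ k → coord (h (punchIn j₀ k)) i
    regroup : ∀ b u H c H₀ → b * c * H₀ + u * b * H ≡ b * (u * H + c * H₀)
    regroup = solve-∀

  combined-independent : ∀ {p} → Prime p → ¬ p ∣ u → IndependentMod p h → IndependentMod p combined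
  combined-independent {p} p-prime p∤u h-indep b relation k
    with euclidsLemma u (b k) p-prime (subst (p ∣_) (lift-punchIn b k) (h-indep (lift b) lifted (punchIn j₀ k)))
    where
    lifted : ∀ i → suc q′ ∣ ∑[ j < suc r ] (lift b j * coord (h j) i)
    lifted i = subst (suc q′ ∣_) (sym (lift-relation b i)) (m%n≡0⇒n∣m _ (suc q′) (begin
      ∑[ k < r ] (b k * X k) % suc q′                 ≡⟨ sum-%-cong {r = r} reduce-coordinate ⟩
      ∑[ k < r ] (b k * coord (combined k) i) % suc q′ ≡⟨ n∣m⇒m%n≡0 _ (suc q′) (relation i) ⟩
      0                                                ∎))
      where
      open ≡-Reasoning
      X = λ k → u * coord (h (punchIn j₀ k)) i + c k * coord (h j₀) i
      reduce-coordinate : ∀ k → (b k * X k) % suc q′ ≡ (b k * coord (combined k) i) % suc q′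
      reduce-coordinate k = begin
        (b k * X k) % suc q′                    ≡⟨ %-cong-* {a = b k} {b k} {X k % suc q′} {X k} refl
                                                               (m%n%n≡m%n (X k) (suc q′)) ⟨
        (b k * (X k % suc q′)) % suc q′         ≡⟨ cong (λ y → (b k * y) % suc q′) (coord-combined k i) ⟨
        (b k * coord (combined k) i) % suc q′   ∎
  ... | inj₁ p∣u = ⊥-elim (p∤u p∣u)
  ... | inj₂ p∣b = p∣b

module Elimination {p t q′ n : ℕ} (p-prime : Prime p) (q≡p^t : suc q′ ≡ p ^ t)
                   {C : Word (suc q′) n → Set} (lin : IsLinearCode C) where

  record Echelon (m s : ℕ) : Set where
    constructor mkEchelon
    field
      size : ℕ
      s≤size : s ≤ size
      family : Fin (suc size) → Word (suc q′) n
      family∈C : ∀ j → C (family j)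
      independent : IndependentMod p family
      vanish : VanishBelow m family

  eliminate-coordinate : ∀ {m s} (i₀ : Fin n) → toℕ i₀ ≡ m → Echelon m (suc s) → Echelon (suc m) s
  eliminate-coordinate {m} {s} i₀ i₀≡m (mkEchelon (suc size) (s≤s s≤size) h h∈C h-indep h-vanish) =
    [ keep , pivot-on ] (all-zero-or-pivot p t column column<q)
    where
    column : Fin (suc (suc size)) → ℕ
    column j = coord (h j) i₀
    column<q : ∀ j → column j < p ^ t
    column<q j = subst (column j <_) q≡p^t (coord<q (h j) i₀)

    keep : (∀ j → column j ≡ 0) → Echelon (suc m) s
    keep column≡0 =
      mkEchelon (suc size) (m≤n⇒m≤1+n s≤size) h h∈C h-indep (VanishBelow-suc {h = h} i₀ i₀≡m h-vanish column≡0)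

    -- With column index = p^v·u (p ∤ u) and column j = p^v·w j, the row u·h j − w j·h index
    -- vanishes in the column; −1 is represented by q′.
    pivot-on : Pivot p column → Echelon (suc m) s
    pivot-on pivot = mkEchelon size s≤size combined (combined∈C lin h∈C)
                       (combined-independent p-prime p∤unit h-indep)
                       (VanishBelow-suc {h = combined} i₀ i₀≡m (combined-vanish h-vanish) cleared)
      where
      open Pivot pivot
      w : Fin (suc (suc size)) → ℕ
      w j = quotient (p^valuation∣ j)
      open Pivoting h index unit (λ k → q′ * w (punchIn index k))
      cleared : ∀ k → coord (combined k) i₀ ≡ 0
      cleared k = begin
        coord (combined k) i₀
          ≡⟨ coord-combined k i₀ ⟩
        (unit * column (punchIn index k) + c * column index) % suc q′
          ≡⟨ cong₂ (λ x y → (unit * x + c * y) % suc q′) (m∣n⇒n≡m*quotient (p^valuation∣ (punchIn index k))) index-value ⟩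
        (unit * (P * wₖ) + q′ * wₖ * (P * unit)) % suc q′
          ≡⟨ cong (_% suc q′) (clear unit P wₖ q′) ⟩
        (wₖ * P * unit * suc q′) % suc q′
          ≡⟨ m*n%n≡0 (wₖ * P * unit) (suc q′) ⟩
        0
          ∎
        where
        open ≡-Reasoning
        P = p ^ valuation
        wₖ = w (punchIn index k)
        c = q′ * wₖ
        clear : ∀ u P w q′ → u * (P * w) + q′ * w * (P * u) ≡ w * P * u * suc q′
        clear = solve-∀

  echelon : ∀ {K′} → Echelon 0 K′ → ∀ m s → m + s ≡ K′ → m ≤ n → Echelon m s
  echelon E₀ zero s refl _ = E₀
  echelon E₀ (suc m) s m+s+1≡K′ m<n =
    eliminate-coordinate (fromℕ< m<n) (Fin.toℕ-fromℕ< m<n)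
                         (echelon E₀ m (suc s) (trans (+-suc m s) m+s+1≡K′) (<⇒≤ m<n))

  independent⇒short-codeword : ∀ {K′} (g : Fin (suc K′) → Word (suc q′) n) → (∀ j → C (g j)) → IndependentMod p g →
                               ∃ λ w → C w × w ≢ zeroW × hammingWt w ≤ n ∸ K′
  independent⇒short-codeword {K′} g g∈C g-indep =
    family Fin.zero , family∈C Fin.zero ,
    independent⇒head≢zeroW {h = family} (nonTrivial⇒n>1 p {{prime⇒nonTrivial p-prime}}) independent ,
    subst (hammingWt (family Fin.zero) ≤_) n∸m≡n∸K′ (hammingWt-vanishing-prefix m (family Fin.zero) (vanish Fin.zero))
    where
    m = K′ ⊓ n
    open Echelon (echelon (mkEchelon K′ ≤-refl g g∈C g-indep (λ _ _ ())) m (K′ ∸ m)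
                          (m+[n∸m]≡n (m⊓n≤m K′ n)) (m⊓n≤n K′ n))
    n∸m≡n∸K′ : n ∸ m ≡ n ∸ K′
    n∸m≡n∸K′ = trans (cong (_∸ m) (sym (m⊓n+n∸m≡n K′ n))) (m+n∸m≡n m (n ∸ K′))

module _ (M N : RawMonoid 0ℓ 0ℓ) (f : RawMonoid.Carrier M → RawMonoid.Carrier N)
         (f-∙ : ∀ x y → f (RawMonoid._∙_ M x y) ≡ RawMonoid._∙_ N (f x) (f y))
         (f-ε : f (RawMonoid.ε M) ≡ RawMonoid.ε N) where
  private
    module M = Multiples M
    module N = Multiples N

  ×-homo : ∀ k x → f (k M.× x) ≡ k N.× f x
  ×-homo zero x = f-ε
  ×-homo (suc k) x = trans (f-∙ x (k M.× x)) (cong (RawMonoid._∙_ N (f x)) (×-homo k x))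

  combination-homo : ∀ {r} (b : Fin r → ℕ) (xs : Fin r → RawMonoid.Carrier M) →
                     f (M.sum (λ j → b j M.× xs j)) ≡ N.sum (λ j → b j N.× f (xs j))
  combination-homo {zero} b xs = f-ε
  combination-homo {suc r} b xs =
    trans (f-∙ _ _) (cong₂ (RawMonoid._∙_ N) (×-homo (b Fin.zero) (xs Fin.zero))
                                             (combination-homo (b ∘ Fin.suc) (xs ∘ Fin.suc)))

module _ (M : RawMonoid 0ℓ 0ℓ) {d : ℕ} .{{_ : NonZero d}} (v : RawMonoid.Carrier M → ℕ)
         (v-∙ : ∀ x y → v (RawMonoid._∙_ M x y) ≡ (v x + v y) % d) (v-ε : v (RawMonoid.ε M) ≡ 0) where
  private
    module M = Multiples M

  ×-mod : ∀ k x → v (k M.× x) ≡ (k * v x) % d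
  ×-mod zero x = trans v-ε (sym (m*n%n≡0 0 d))
  ×-mod (suc k) x = begin
    v (x ∙ k M.× x)                ≡⟨ v-∙ x (k M.× x) ⟩
    (v x + v (k M.× x)) % d        ≡⟨ cong (λ y → (v x + y) % d) (×-mod k x) ⟩
    (v x + (k * v x) % d) % d      ≡⟨ %-cong-+ {a = v x} {v x} refl (m%n%n≡m%n (k * v x) d) ⟩
    (v x + k * v x) % d            ∎
    where
    open ≡-Reasoning
    open RawMonoid M using (_∙_)

  combination-mod : ∀ {r} (b : Fin r → ℕ) (xs : Fin r → RawMonoid.Carrier M) →
                    v (M.sum (λ j → b j M.× xs j)) ≡ (∑[ j < r ] (b j * v (xs j))) % d
  combination-mod {zero} b xs = trans v-ε (sym (m*n%n≡0 0 d))
  combination-mod {suc r} b xs = begin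
    v (b₀ M.× x₀ ∙ rest)                                       ≡⟨ v-∙ (b₀ M.× x₀) rest ⟩
    (v (b₀ M.× x₀) + v rest) % d                               ≡⟨ cong₂ (λ y z → (y + z) % d) (×-mod b₀ x₀)
                                                                    (combination-mod (b ∘ Fin.suc) (xs ∘ Fin.suc)) ⟩
    ((b₀ * v x₀) % d + (∑[ j < r ] (b (Fin.suc j) * v (xs (Fin.suc j)))) % d) % d
                                                               ≡⟨ %-distribˡ-+ (b₀ * v x₀) _ d ⟨
    (b₀ * v x₀ + ∑[ j < r ] (b (Fin.suc j) * v (xs (Fin.suc j)))) % d ∎
    where
    open ≡-Reasoning
    open RawMonoid M using (_∙_)
    b₀ = b Fin.zero
    x₀ = xs Fin.zero
    rest = M.sum (λ j → b (Fin.suc j) M.× xs (Fin.suc j))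

wordMonoid : ℕ → ℕ → RawMonoid 0ℓ 0ℓ
wordMonoid q′ n = record { Carrier = Word (suc q′) n ; _≈_ = _≡_ ; _∙_ = addW ; ε = zeroW }

addW-zeroW : ∀ {q′ n} → addW (zeroW {q′} {n}) zeroW ≡ zeroW
addW-zeroW {q′} = coords≡0⇒≡zeroW _ (λ i →
  trans (coord-addW zeroW zeroW i) (cong₂ (λ x y → (x + y) % suc q′) (coord-zeroW i) (coord-zeroW i)))

module StandardBasis {p t q′ n K : ℕ} (p-prime : Prime p) {C : Word (suc q′) n → Set} (lin : IsLinearCode C)
                     {e : Fin K → ℕ} (type : HasType C p t K e) where
  open HasType type
  private
    instance
      p≢0 : NonZero p
      p≢0 = prime⇒nonZero p-prime
      p^e≢0 : ∀ {k} → NonZero (p ^ e k)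
      p^e≢0 {k} = m^n≢0 p (e k)
      p^e-1≢0 : ∀ {k} → NonZero (p ^ (e k ∸ 1))
      p^e-1≢0 {k} = m^n≢0 p (e k ∸ 1)
    module W = Multiples (wordMonoid q′ n)

  -- φ is not known to respect pointwise equality of elements of Elt p K e, so the neutral
  -- element is taken to be the preimage of zeroW rather than the pointwise zero.
  zeroE : Elt p K e
  zeroE = proj₁ (φ-onto zeroW (IsLinearCode.has-zero lin))

  φ-zeroE : φ zeroE ≡ zeroW
  φ-zeroE = proj₂ (φ-onto zeroW (IsLinearCode.has-zero lin))

  toℕ-zeroE : ∀ k → toℕ (zeroE k) ≡ 0
  toℕ-zeroE k = x+x≡x⇒x≡0 (Fin.toℕ<n (zeroE k))
                  (trans (sym (toℕ-addF (zeroE k) (zeroE k))) (cong toℕ (φ-inj _ _ φ[0+0]≡φ0 k)))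
    where
    φ[0+0]≡φ0 : φ (addE {p} {K} {e} zeroE zeroE) ≡ φ zeroE
    φ[0+0]≡φ0 = trans (φ-add zeroE zeroE) (trans (cong₂ addW φ-zeroE φ-zeroE) (trans addW-zeroW (sym φ-zeroE)))

  eltMonoid : RawMonoid 0ℓ 0ℓ
  eltMonoid = record { Carrier = Elt p K e ; _≈_ = _≡_ ; _∙_ = addE {p} {K} {e} ; ε = zeroE }

  private
    module E = Multiples eltMonoid

  p^e≡p*p^e-1 : ∀ k → p ^ e k ≡ p * p ^ (e k ∸ 1)
  p^e≡p*p^e-1 k with e k | proj₁ (exp-range k)
  ... | suc e-1 | _ = refl

  basis : Fin K → Elt p K e
  basis j k with j Fin.≟ k
  ... | yes _ = fromℕ< (subst (p ^ (e k ∸ 1) <_) (trans (*-comm (p ^ (e k ∸ 1)) p) (sym (p^e≡p*p^e-1 k)))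
                         (m<m*n (p ^ (e k ∸ 1)) p (nonTrivial⇒n>1 p {{prime⇒nonTrivial p-prime}})))
  ... | no _ = fromℕ< (>-nonZero⁻¹ (p ^ e k))

  toℕ-basis-diagonal : ∀ k → toℕ (basis k k) ≡ p ^ (e k ∸ 1)
  toℕ-basis-diagonal k with k Fin.≟ k
  ... | yes _ = Fin.toℕ-fromℕ< _
  ... | no k≢k = ⊥-elim (k≢k refl)

  toℕ-basis-off-diagonal : ∀ j k → j ≢ k → toℕ (basis j k) ≡ 0
  toℕ-basis-off-diagonal j k j≢k with j Fin.≟ k
  ... | yes j≡k = ⊥-elim (j≢k j≡k)
  ... | no _ = Fin.toℕ-fromℕ< _

  codeword : Fin K → Word (suc q′) n
  codeword j = φ (basis j)

  codeword∈C : ∀ j → C (codeword j)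
  codeword∈C j = φ-into (basis j)

  codeword-independent : IndependentMod p codeword
  codeword-independent b relation k =
    *-cancelʳ-∣ (p ^ (e k ∸ 1))
                (subst (_∣ b k * p ^ (e k ∸ 1)) (p^e≡p*p^e-1 k) (m%n≡0⇒n∣m _ (p ^ e k) bₖ·basis≡0))
    where
    x : Elt p K e
    x = E.sum (λ j → b j E.× basis j)
    combination≡zeroW : W.sum (λ j → b j W.× codeword j) ≡ zeroW
    combination≡zeroW = coords≡0⇒≡zeroW _ (λ i →
      trans (combination-mod (wordMonoid q′ n) (λ w → coord w i) (λ u v → coord-addW u v i) (coord-zeroW i) b codeword)
            (n∣m⇒m%n≡0 _ (suc q′) (relation i)))
    x≗zeroE : ∀ k → x k ≡ zeroE k
    x≗zeroE = φ-inj x zeroE (trans (combination-homo eltMonoid (wordMonoid q′ n) φ φ-add φ-zeroE b basis)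
                                   (trans combination≡zeroW (sym φ-zeroE)))
    bₖ·basis≡0 : (b k * p ^ (e k ∸ 1)) % p ^ e k ≡ 0
    bₖ·basis≡0 = begin
      (b k * p ^ (e k ∸ 1)) % p ^ e k                ≡⟨ cong (λ y → (b k * y) % p ^ e k) (toℕ-basis-diagonal k) ⟨
      (b k * toℕ (basis k k)) % p ^ e k              ≡⟨ cong (_% p ^ e k)
                                                             (sum-single (λ j → b j * toℕ (basis j k)) k off-diagonal) ⟨
      (∑[ j < K ] (b j * toℕ (basis j k))) % p ^ e k ≡⟨ combination-mod eltMonoid (λ y → toℕ (y k))
                                                           (λ y z → toℕ-addF (y k) (z k)) (toℕ-zeroE k) b basis ⟨
      toℕ (x k)                                      ≡⟨ cong toℕ (x≗zeroE k) ⟩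
      toℕ (zeroE k)                                  ≡⟨ toℕ-zeroE k ⟩
      0                                              ∎
      where
      open ≡-Reasoning
      off-diagonal : ∀ j → j ≢ k → b j * toℕ (basis j k) ≡ 0
      off-diagonal j j≢k = trans (cong (b j *_) (toℕ-basis-off-diagonal j k j≢k)) (*-zeroʳ (b j))

generalized-singleton : ∀ {p t q′ n K′} → Prime p → suc q′ ≡ p ^ t →
                        {C : Word (suc q′) n → Set} → IsLinearCode C → ∀ {e} → HasType C p t (suc K′) e →
                        ∃ λ w → C w × w ≢ zeroW × hammingWt w ≤ n ∸ K′
generalized-singleton {t = t} p-prime q≡p^t lin type =
  Elimination.independent⇒short-codeword {t = t} p-prime q≡p^t lin codeword codeword∈C codeword-independent
  where open StandardBasis p-prime lin type

lemma25 : (p t q' n K dL : ℕ) → Prime p → 1 ≤ t → suc q' ≡ p ^ t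
    → (C : Word (suc q') n → Set) → IsLinearCode C → HasRank C p t K
    → MinLee C dL
    → p ^ (t ∸ 1) * fourμ p * (n ∸ K) < 4 * dL
    → IsMDR C p t K × (IsFreeOfRank C p t K → IsMDS C p t K)
lemma25 p (suc t) q′ n K dL p-prime _ q≡p^t+1 C lin rank minLee bound = (rank , minHamming) , λ free → free , minHamming
  where
  n∸K<hammingWt : ∀ c → C c → c ≢ zeroW → n ∸ K < hammingWt c
  n∸K<hammingWt c c∈C c≢0 = ≰⇒> λ small →
    <⇒≱ bound (≤-trans (4*minLee≤p^t*fourμ*hammingWt {t = t} p-prime q≡p^t+1 lin minLee c c∈C c≢0)
                       (*-monoʳ-≤ (p ^ t * fourμ p) small))

  attained : ∀ {K} → HasRank C p (suc t) K → (∀ c → C c → c ≢ zeroW → n ∸ K < hammingWt c) →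
             ∃ λ w → C w × w ≢ zeroW × hammingWt w ≡ n ∸ K + 1
  attained {zero} _ n<wt = ⊥-elim (no-nonzero-codeword (proj₁ minLee))
    where
    no-nonzero-codeword : ¬ ∃ λ c → C c × c ≢ zeroW × leeWt c ≡ dL
    no-nonzero-codeword (c , c∈C , c≢0 , _) = <⇒≱ (n<wt c c∈C c≢0) (hammingWt≤length c)
  attained {suc K′} (_ , type) n∸K<wt = exact (generalized-singleton p-prime q≡p^t+1 lin type)
    where
    exact : (∃ λ w → C w × w ≢ zeroW × hammingWt w ≤ n ∸ K′) →
            ∃ λ w → C w × w ≢ zeroW × hammingWt w ≡ n ∸ suc K′ + 1
    exact (w , w∈C , w≢0 , w≤) =
      w , w∈C , w≢0 , trans (≤-antisym (≤-trans w≤ (∸≤suc∸suc n K′)) (n∸K<wt w w∈C w≢0)) (+-comm 1 (n ∸ suc K′))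

  minHamming : MinHamming C (n ∸ K + 1)
  minHamming = attained rank n∸K<hammingWt ,
               λ c c∈C c≢0 → subst (_≤ hammingWt c) (+-comm 1 (n ∸ K)) (n∸K<hammingWt c c∈C c≢0)
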